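{- Let $K$ be the infinite king grid. There exist a RED:LD set, a DET:LD set and an ERR:LD set on $K$ of densities $\frac{5}{16}$, $\frac{3}{8}$ and $\frac{7}{16}$, respectively. Consequently $\mathrm{RED{:}LD}(K)\le \frac{5}{16}$, $\mathrm{DET{:}LD}(K)\le \frac{3}{8}$ and $\mathrm{ERR{:}LD}(K)\le \frac{7}{16}$.
   Context: The infinite king grid $K$ has vertex set $\mathbb{Z}^2$, with distinct vertices $(a,b),(c,d)$ adjacent iff $\max(|a-c|,|b-d|)=1$. For a vertex $v$, $N(v)$ is its open neighborhood and $N[v]=N(v)\cup\{v\}$. For $S\subseteq V(K)$: - $S$ is a RED:LD (redundant locating-dominating) set iff (i) for all $v\in V(K)$, $|N[v]\cap S|\ge 2$; (ii) for all $v\in S$ and $u\in V(K)\setminus S$, $|((N(v)\cap S)\triangle(N(u)\cap S))\setminus\{v\}|\ge 1$; (iii) for all distinct $u,v\in V(K)\setminus S$, $|(N(v)\cap S)\triangle(N(u)\cap S)|\ge 2$. - $S$ is a DET:LD (error-detecting locating-dominating) set iff (i) for all $v\in V(K)$, $|N[v]\cap S|\ge 2$; (ii) for all distinct $u,v\in S$, $|(N(v)\cap S)\triangle(N(u)\cap S)|\ge 1$; (iii) for all $v\in V(K)\setminus S$ and $u\in S$, $|(N(v)\cap S)\setminus(N(u)\cap S)|\ge 2$ or $|(N(u)\cap S)\setminus(N(v)\cap S)|\ge 1$; (iv) for all distinct $u,v\in V(K)\setminus S$, $|(N(v)\cap S)\setminus(N(u)\cap S)|\ge 2$ or $|(N(u)\cap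 S)\setminus(N(v)\cap S)|\ge 2$. - $S$ is an ERR:LD (error-correcting locating-dominating) set iff (i) for all $v\in V(K)$, $|N[v]\cap S|\ge 3$; (ii) for all distinct $u,v\in S$, $|((N(v)\cap S)\triangle(N(u)\cap S))\setminus\{v,u\}|\ge 1$; (iii) for all $v\in V(K)\setminus S$ and $u\in S$, $|((N(v)\cap S)\triangle(N(u)\cap S))\setminus\{u\}|\ge 2$; (iv) for all distinct $u,v\in V(K)\setminus S$, $|(N(v)\cap S)\triangle(N(u)\cap S)|\ge 3$. The density of $S\subseteq\mathbb{Z}^2$ is $\limsup_{n\to\infty}|S\cap Q_n|/|Q_n|$ where $Q_n=\{ -n,\dots,n\}^2$ (for periodic sets this equals the density within one period tile). $\mathrm{RED{:}LD}(K)$, $\mathrm{DET{:}LD}(K)$, $\mathrm{ERR{:}LD}(K)$ denote the infimum of the densities of RED:LD, DET:LD, ERR:LD sets on $K$, respectively. -}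

module Defs where

open import Data.Bool using (Bool; true; false; _∧_; not; if_then_else_)
open import Data.Nat as ℕ using (ℕ; zero; suc; _⊔_; _≡ᵇ_)
open import Data.Integer as ℤ using (ℤ; +_; -[1+_]; ∣_∣)
open import Data.Product using (_×_; _,_; ∃; ∃-syntax; Σ-syntax)
open import Data.Sum using (_⊎_)
open import Data.List using (List; []; _∷_; map; concatMap; filter; length; upTo)
open import Data.Bool.ListAction using (any)
open import Data.Rational as ℚ using (ℚ; 0ℚ)
open import Relation.Binary.PropositionalEquality using (_≡_; _≢_)
open import Relation.Nullary.Decidable using (T?)
open import Data.Bool using (T)

V : Set
V = ℤ × ℤ

Subset : Set
Subset = V → Bool

cheb : V → V → ℕ
cheb (a , b) (c , d) = ∣ a ℤ.- c ∣ ⊔ ∣ b ℤ.- d ∣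

adj : V → V → Bool
adj u w = cheb u w ≡ᵇ 1

eqV : V → V → Bool
eqV u w = cheb u w ≡ᵇ 0

N : V → List V
N (a , b) =
  (a ℤ.+ ℤ.-1ℤ , b ℤ.+ ℤ.-1ℤ) ∷ (a ℤ.+ ℤ.-1ℤ , b) ∷ (a ℤ.+ ℤ.-1ℤ , b ℤ.+ ℤ.1ℤ) ∷
  (a , b ℤ.+ ℤ.-1ℤ) ∷ (a , b ℤ.+ ℤ.1ℤ) ∷
  (a ℤ.+ ℤ.1ℤ , b ℤ.+ ℤ.-1ℤ) ∷ (a ℤ.+ ℤ.1ℤ , b) ∷ (a ℤ.+ ℤ.1ℤ , b ℤ.+ ℤ.1ℤ) ∷ []

inList : V → List V → Bool
inList w X = any (eqV w) X

closedCount : Subset → V → ℕ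
closedCount S v = (if S v then 1 else 0) ℕ.+ length (filter (λ w → T? (S w)) (N v))

-- |((N(v) ∩ S) \ (N(u) ∩ S)) \ X|
diffEx : Subset → V → V → List V → ℕ
diffEx S v u X =
  length (filter (λ w → T? (S w ∧ not (adj u w) ∧ not (inList w X))) (N v))

-- |((N(v) ∩ S) △ (N(u) ∩ S)) \ X|
symDiffEx : Subset → V → V → List V → ℕ
symDiffEx S v u X = diffEx S v u X ℕ.+ diffEx S u v X

_∈S_ : V → Subset → Set
v ∈S S = S v ≡ true

_∉S_ : V → Subset → Set
v ∉S S = S v ≡ false

RedLD : Subset → Set
RedLD S =
  (∀ v → 2 ℕ.≤ closedCount S v) ×
  (∀ v u → v ∈S S → u ∉S S → 1 ℕ.≤ symDiffEx S v u (v ∷ [])) ×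
  (∀ u v → u ≢ v → u ∉S S → v ∉S S → 2 ℕ.≤ symDiffEx S v u [])

DetLD : Subset → Set
DetLD S =
  (∀ v → 2 ℕ.≤ closedCount S v) ×
  (∀ u v → u ≢ v → u ∈S S → v ∈S S → 1 ℕ.≤ symDiffEx S v u []) ×
  (∀ v u → v ∉S S → u ∈S S → (2 ℕ.≤ diffEx S v u []) ⊎ (1 ℕ.≤ diffEx S u v [])) ×
  (∀ u v → u ≢ v → u ∉S S → v ∉S S → (2 ℕ.≤ diffEx S v u []) ⊎ (2 ℕ.≤ diffEx S u v []))

ErrLD : Subset → Set
ErrLD S =
  (∀ v → 3 ℕ.≤ closedCount S v) ×
  (∀ u v → u ≢ v → u ∈S S → v ∈S S → 1 ℕ.≤ symDiffEx S v u (v ∷ u ∷ [])) ×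
  (∀ v u → v ∉S S → u ∈S S → 2 ℕ.≤ symDiffEx S v u (u ∷ [])) ×
  (∀ u v → u ≢ v → u ∉S S → v ∉S S → 3 ℕ.≤ symDiffEx S v u [])

range : ℕ → List ℤ
range n = map (λ k → + k ℤ.- + n) (upTo (suc (n ℕ.+ n)))

-- |S ∩ Q_n|, Q_n = {-n,…,n}²
countQ : Subset → ℕ → ℕ
countQ S n = length (filter (λ p → T? (S p))
  (concatMap (λ i → map (λ j → (i , j)) (range n)) (range n)))

ratio : Subset → ℕ → ℚ
ratio S n = (+ countQ S n) ℚ./ (suc (n ℕ.+ n) ℕ.* suc (n ℕ.+ n))

-- density(S) = limsup_{n→∞} ratio S n = q  (standard ε-characterisation, ε rational)
HasDensity : Subset → ℚ → Set
HasDensity S q =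
  (∀ (ε : ℚ) → 0ℚ ℚ.< ε → ∃[ M ] ∀ n → M ℕ.≤ n → ratio S n ℚ.≤ q ℚ.+ ε) ×
  (∀ (ε : ℚ) → 0ℚ ℚ.< ε → ∀ M → ∃[ n ] (M ℕ.≤ n × q ℚ.- ε ℚ.≤ ratio S n))

{-# OPTIONS --safe #-}

-- The three sets are 4×4-periodic, cut out by tiles with 5, 6 and 7 cells. Every
-- condition in their definitions is invariant under translation by 4ℤ², so domination
-- reduces to the 16 vertices of one tile. If v and u are at Chebyshev distance at least 3,
-- no neighbour of one is equal or adjacent to the other, so the symmetric differences are
-- N(v) ∩ S and N(u) ∩ S, which depend only on residues mod 4; a pair at distance at most
-- 2 is, up to a period, one of the 16 · 24 pairs of a tile vertex and a nearby vertex.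
-- These finitely many cases are decided by evaluation. For the density, any L consecutive
-- integers cover each residue mod 4 between L/4 - 1 and L/4 + 1 times, so a box of side
-- L = 2n + 1 meets the set in c L²/16 + O(L) vertices, c the number of cells of the tile.

module Submission where

open import Defs
open import Data.Bool using (Bool; true; false; _∧_; _∨_; not; if_then_else_)
import Data.Bool.Properties as Boolₚ
open import Data.Nat as ℕ using (ℕ; zero; suc; _≤_; _⊔_; _≡ᵇ_; z≤n; s≤s; _≤?_; NonZero)
import Data.Nat.Properties as ℕₚ
import Data.Nat.Tactic.RingSolver as ℕSolver
open import Data.Nat.ListAction using (sum)
open import Data.Integer as ℤ using (ℤ; +_; -[1+_]; ∣_∣; 1ℤ; -1ℤ; +≤+)
import Data.Integer.Properties as ℤₚ
import Data.Integer.Tactic.RingSolver as ℤSolver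
open import Data.Rational as ℚ using (ℚ; mkℚ; 0ℚ; _/_; toℚᵘ) renaming (_≤_ to _≤ᵠ_)
import Data.Rational.Properties as ℚₚ
open import Data.Rational.Unnormalised as ℚᵘ using (mkℚᵘ; *≤*)
import Data.Rational.Unnormalised.Properties as ℚᵘₚ
open import Data.Fin as Fin using (Fin)
import Data.Fin.Properties as Finₚ
open import Data.List using (List; []; _∷_; map; filter; length; _++_; concatMap; applyUpTo)
import Data.List.Properties as Listₚ
open import Data.List.Relation.Unary.All as All using (All; []; _∷_)
open import Data.Product using (_×_; _,_; proj₁; proj₂; map₂; ∃-syntax)
import Data.Product.Properties as Productₚ
open import Data.Sum using ([_,_]′)
open import Function using (_∘_)
open import Relation.Nullary using (Dec; ¬_; ¬?)
open import Relation.Nullary.Decidable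
  using (T?; True; toWitness; toSum; map′; _×-dec_; _⊎-dec_; _→-dec_)
open import Relation.Unary using (Decidable)
open import Relation.Binary.PropositionalEquality

-- Residues modulo 4

data ℤ₄ : Set where
  0₄ 1₄ 2₄ 3₄ : ℤ₄

suc₄ : ℤ₄ → ℤ₄
suc₄ 0₄ = 1₄
suc₄ 1₄ = 2₄
suc₄ 2₄ = 3₄
suc₄ 3₄ = 0₄

pred₄ : ℤ₄ → ℤ₄
pred₄ r = suc₄ (suc₄ (suc₄ r))

suc₄⁴ : ∀ r → suc₄ (suc₄ (suc₄ (suc₄ r))) ≡ r
suc₄⁴ 0₄ = refl
suc₄⁴ 1₄ = refl
suc₄⁴ 2₄ = refl
suc₄⁴ 3₄ = refl

infixl 6 _+₄_

_+₄_ : ℤ₄ → ℤ₄ → ℤ₄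
r +₄ 0₄ = r
r +₄ 1₄ = suc₄ r
r +₄ 2₄ = suc₄ (suc₄ r)
r +₄ 3₄ = pred₄ r

+₄-suc₄ : ∀ r s → r +₄ suc₄ s ≡ suc₄ (r +₄ s)
+₄-suc₄ r 0₄ = refl
+₄-suc₄ r 1₄ = refl
+₄-suc₄ r 2₄ = refl
+₄-suc₄ r 3₄ = sym (suc₄⁴ r)

+₄-pred₄ : ∀ r s → r +₄ pred₄ s ≡ pred₄ (r +₄ s)
+₄-pred₄ r 0₄ = refl
+₄-pred₄ r 1₄ = sym (suc₄⁴ r)
+₄-pred₄ r 2₄ = sym (suc₄⁴ (suc₄ r))
+₄-pred₄ r 3₄ = sym (suc₄⁴ (suc₄ (suc₄ r)))

fromℕ₄ : ℕ → ℤ₄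
fromℕ₄ zero    = 0₄
fromℕ₄ (suc n) = suc₄ (fromℕ₄ n)

fromNegSuc₄ : ℕ → ℤ₄
fromNegSuc₄ zero    = 3₄
fromNegSuc₄ (suc n) = pred₄ (fromNegSuc₄ n)

[_]₄ : ℤ → ℤ₄
[ + n ]₄      = fromℕ₄ n
[ -[1+ n ] ]₄ = fromNegSuc₄ n

toℤ : ℤ₄ → ℤ
toℤ 0₄ = + 0
toℤ 1₄ = + 1
toℤ 2₄ = + 2
toℤ 3₄ = + 3

[x+1]₄ : ∀ x → [ x ℤ.+ 1ℤ ]₄ ≡ suc₄ [ x ]₄
[x+1]₄ (+ n)        = cong fromℕ₄ (ℕₚ.+-comm n 1)
[x+1]₄ -[1+ zero ]  = refl
[x+1]₄ -[1+ suc n ] = sym (suc₄⁴ (fromNegSuc₄ n))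

[x-1]₄ : ∀ x → [ x ℤ.+ -1ℤ ]₄ ≡ pred₄ [ x ]₄
[x-1]₄ x = begin
  [ x ℤ.+ -1ℤ ]₄                        ≡⟨ suc₄⁴ _ ⟨
  pred₄ (suc₄ [ x ℤ.+ -1ℤ ]₄)           ≡⟨ cong pred₄ ([x+1]₄ (x ℤ.+ -1ℤ)) ⟨
  pred₄ [ (x ℤ.+ -1ℤ) ℤ.+ 1ℤ ]₄         ≡⟨ cong (pred₄ ∘ [_]₄) (cancel x) ⟩
  pred₄ [ x ]₄                          ∎
  where
  open ≡-Reasoning
  cancel : ∀ y → (y ℤ.+ -1ℤ) ℤ.+ 1ℤ ≡ y
  cancel = ℤSolver.solve-∀

-- The steps below use that + suc n and -[1+ suc n ] compute to 1ℤ ℤ.+ + n and -1ℤ ℤ.+ -[1+ n ].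
[+]₄ : ∀ x y → [ x ℤ.+ y ]₄ ≡ [ x ]₄ +₄ [ y ]₄
[+]₄ x (+ zero)     = cong [_]₄ (ℤₚ.+-identityʳ x)
[+]₄ x (+ suc n)    = begin
  [ x ℤ.+ + suc n ]₄                    ≡⟨ cong [_]₄ (step x (+ n)) ⟩
  [ (x ℤ.+ + n) ℤ.+ 1ℤ ]₄               ≡⟨ [x+1]₄ (x ℤ.+ + n) ⟩
  suc₄ [ x ℤ.+ + n ]₄                   ≡⟨ cong suc₄ ([+]₄ x (+ n)) ⟩
  suc₄ ([ x ]₄ +₄ fromℕ₄ n)             ≡⟨ +₄-suc₄ [ x ]₄ (fromℕ₄ n) ⟨
  [ x ]₄ +₄ fromℕ₄ (suc n)              ∎
  where
  open ≡-Reasoning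
  step : ∀ x y → x ℤ.+ (1ℤ ℤ.+ y) ≡ (x ℤ.+ y) ℤ.+ 1ℤ
  step = ℤSolver.solve-∀
[+]₄ x -[1+ zero ]  = [x-1]₄ x
[+]₄ x -[1+ suc n ] = begin
  [ x ℤ.+ -[1+ suc n ] ]₄               ≡⟨ cong [_]₄ (step x -[1+ n ]) ⟩
  [ (x ℤ.+ -[1+ n ]) ℤ.+ -1ℤ ]₄         ≡⟨ [x-1]₄ (x ℤ.+ -[1+ n ]) ⟩
  pred₄ [ x ℤ.+ -[1+ n ] ]₄             ≡⟨ cong pred₄ ([+]₄ x -[1+ n ]) ⟩
  pred₄ ([ x ]₄ +₄ fromNegSuc₄ n)       ≡⟨ +₄-pred₄ [ x ]₄ (fromNegSuc₄ n) ⟨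
  [ x ]₄ +₄ fromNegSuc₄ (suc n)         ∎
  where
  open ≡-Reasoning
  step : ∀ x y → x ℤ.+ (-1ℤ ℤ.+ y) ≡ (x ℤ.+ y) ℤ.+ -1ℤ
  step = ℤSolver.solve-∀

[x-toℤ[x]]₄ : ∀ x → [ x ℤ.- toℤ [ x ]₄ ]₄ ≡ 0₄
[x-toℤ[x]]₄ x = trans ([+]₄ x (ℤ.- toℤ [ x ]₄)) (cancel [ x ]₄)
  where
  cancel : ∀ r → r +₄ [ ℤ.- toℤ r ]₄ ≡ 0₄
  cancel 0₄ = refl
  cancel 1₄ = refl
  cancel 2₄ = refl
  cancel 3₄ = refl

count : {A : Set} → (A → Bool) → List A → ℕ
count P xs = length (filter (λ x → T? (P x)) xs)

count-congᴬ : ∀ {A : Set} {P Q : A → Bool} {xs} → All (λ x → P x ≡ Q x) xs → count P xs ≡ count Q xs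
count-congᴬ                 []         = refl
count-congᴬ {Q = Q} {x ∷ _} (eq ∷ eqs) rewrite eq with Q x
... | true  = cong suc (count-congᴬ eqs)
... | false = count-congᴬ eqs

count-cong : ∀ {A : Set} {P Q : A → Bool} → (∀ x → P x ≡ Q x) → ∀ xs → count P xs ≡ count Q xs
count-cong eq xs = count-congᴬ (All.universal eq xs)

count-map : ∀ {A B : Set} (P : B → Bool) (f : A → B) xs → count P (map f xs) ≡ count (P ∘ f) xs
count-map P f []       = refl
count-map P f (x ∷ xs) with P (f x)
... | true  = cong suc (count-map P f xs)
... | false = count-map P f xs

indicator : Bool → ℕ
indicator b = if b then 1 else 0

indicator≤1 : ∀ b → indicator b ≤ 1
indicator≤1 true  = s≤s z≤n
indicator≤1 false = z≤n

count≡sum : ∀ {A : Set} (P : A → Bool) xs → count P xs ≡ sum (map (indicator ∘ P) xs)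
count≡sum P []       = refl
count≡sum P (x ∷ xs) with P x
... | true  = cong suc (count≡sum P xs)
... | false = count≡sum P xs

count-concatMap : ∀ {A B : Set} (P : B → Bool) (f : A → List B) xs →
                  count P (concatMap f xs) ≡ sum (map (count P ∘ f) xs)
count-concatMap P f []       = refl
count-concatMap P f (x ∷ xs) = begin
  count P (f x ++ concatMap f xs)                        ≡⟨ cong length (Listₚ.filter-++ P? (f x) _) ⟩
  length (filter P? (f x) ++ filter P? (concatMap f xs)) ≡⟨ Listₚ.length-++ (filter P? (f x)) ⟩
  count P (f x) ℕ.+ count P (concatMap f xs)
    ≡⟨ cong (count P (f x) ℕ.+_) (count-concatMap P f xs) ⟩
  count P (f x) ℕ.+ sum (map (count P ∘ f) xs)           ∎
  where
  open ≡-Reasoning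
  P? = λ y → T? (P y)

-- Translations of the king grid

infixl 6 _+ᵥ_

_+ᵥ_ : V → V → V
(a , b) +ᵥ (c , d) = (a ℤ.+ c , b ℤ.+ d)

N-+ᵥ : ∀ v t → N (v +ᵥ t) ≡ map (_+ᵥ t) (N v)
N-+ᵥ (a , b) (t₁ , t₂) =
  cong₂ _∷_ (cong₂ _,_ (swap a t₁ -1ℤ) (swap b t₂ -1ℤ)) (
  cong₂ _∷_ (cong₂ _,_ (swap a t₁ -1ℤ) refl) (
  cong₂ _∷_ (cong₂ _,_ (swap a t₁ -1ℤ) (swap b t₂ 1ℤ)) (
  cong₂ _∷_ (cong₂ _,_ refl (swap b t₂ -1ℤ)) (
  cong₂ _∷_ (cong₂ _,_ refl (swap b t₂ 1ℤ)) (
  cong₂ _∷_ (cong₂ _,_ (swap a t₁ 1ℤ) (swap b t₂ -1ℤ)) (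
  cong₂ _∷_ (cong₂ _,_ (swap a t₁ 1ℤ) refl) (
  cong₂ _∷_ (cong₂ _,_ (swap a t₁ 1ℤ) (swap b t₂ 1ℤ)) refl)))))))
  where
  swap : ∀ a t c → (a ℤ.+ t) ℤ.+ c ≡ (a ℤ.+ c) ℤ.+ t
  swap = ℤSolver.solve-∀

count-N-+ᵥ : ∀ {P Q : V → Bool} t → (∀ w → P (w +ᵥ t) ≡ Q w) →
             ∀ v → count P (N (v +ᵥ t)) ≡ count Q (N v)
count-N-+ᵥ {P} {Q} t eq v = begin
  count P (N (v +ᵥ t))            ≡⟨ cong (count P) (N-+ᵥ v t) ⟩
  count P (map (_+ᵥ t) (N v))     ≡⟨ count-map P (_+ᵥ t) (N v) ⟩
  count (P ∘ (_+ᵥ t)) (N v)       ≡⟨ count-cong eq (N v) ⟩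
  count Q (N v)                   ∎
  where open ≡-Reasoning

cheb-+ᵥ : ∀ u w t → cheb (u +ᵥ t) (w +ᵥ t) ≡ cheb u w
cheb-+ᵥ (a , b) (c , d) (t₁ , t₂) = cong₂ _⊔_ (cong ∣_∣ (cancel a c t₁)) (cong ∣_∣ (cancel b d t₂))
  where
  cancel : ∀ a c t → (a ℤ.+ t) ℤ.- (c ℤ.+ t) ≡ a ℤ.- c
  cancel = ℤSolver.solve-∀

inList-+ᵥ : ∀ w X t → inList (w +ᵥ t) (map (_+ᵥ t) X) ≡ inList w X
inList-+ᵥ w []      t = refl
inList-+ᵥ w (x ∷ X) t = cong₂ _∨_ (cong (_≡ᵇ 0) (cheb-+ᵥ w x t)) (inList-+ᵥ w X t)

Invariant : Subset → V → Set
Invariant S t = ∀ w → S (w +ᵥ t) ≡ S w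

diffEx-+ᵥ : ∀ {S t} → Invariant S t → ∀ v u X →
            diffEx S (v +ᵥ t) (u +ᵥ t) (map (_+ᵥ t) X) ≡ diffEx S v u X
diffEx-+ᵥ {S} {t} inv v u X = count-N-+ᵥ {separates (u +ᵥ t) (map (_+ᵥ t) X)} {separates u X} t
  (λ w → cong₂ _∧_ (inv w)
           (cong₂ _∧_ (cong (not ∘ (_≡ᵇ 1)) (cheb-+ᵥ u w t)) (cong not (inList-+ᵥ w X t))))
  v
  where
  separates : V → List V → V → Bool
  separates u X w = S w ∧ not (adj u w) ∧ not (inList w X)

closedCount-+ᵥ : ∀ {S t} → Invariant S t → ∀ v → closedCount S (v +ᵥ t) ≡ closedCount S v
closedCount-+ᵥ {S} {t} inv v =
  cong₂ (λ b n → (if b then 1 else 0) ℕ.+ n) (inv v) (count-N-+ᵥ {S} {S} t inv v)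

-- Near and far pairs

cheb-sym : ∀ u w → cheb u w ≡ cheb w u
cheb-sym (a , b) (c , d) = cong₂ _⊔_ (ℤₚ.∣i-j∣≡∣j-i∣ a c) (ℤₚ.∣i-j∣≡∣j-i∣ b d)

cheb-triangle : ∀ u v w → cheb u w ≤ cheb u v ℕ.+ cheb v w
cheb-triangle (a , b) (c , d) (e , f) = ℕₚ.⊔-lub
  (ℕₚ.≤-trans (coordinate a c e) (ℕₚ.+-mono-≤ (ℕₚ.m≤m⊔n ∣ a ℤ.- c ∣ ∣ b ℤ.- d ∣)
                                               (ℕₚ.m≤m⊔n ∣ c ℤ.- e ∣ ∣ d ℤ.- f ∣)))
  (ℕₚ.≤-trans (coordinate b d f) (ℕₚ.+-mono-≤ (ℕₚ.m≤n⊔m ∣ a ℤ.- c ∣ ∣ b ℤ.- d ∣)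
                                               (ℕₚ.m≤n⊔m ∣ c ℤ.- e ∣ ∣ d ℤ.- f ∣)))
  where
  split : ∀ x y z → x ℤ.- z ≡ (x ℤ.- y) ℤ.+ (y ℤ.- z)
  split = ℤSolver.solve-∀
  coordinate : ∀ x y z → ∣ x ℤ.- z ∣ ≤ ∣ x ℤ.- y ∣ ℕ.+ ∣ y ℤ.- z ∣
  coordinate x y z = subst (λ i → ∣ i ∣ ≤ ∣ x ℤ.- y ∣ ℕ.+ ∣ y ℤ.- z ∣) (sym (split x y z))
    (ℤₚ.∣i+j∣≤∣i∣+∣j∣ (x ℤ.- y) (y ℤ.- z))

N-adjacent : ∀ v → All (λ w → cheb v w ≡ 1) (N v)
N-adjacent (a , b) =
  cong₂ _⊔_ (step a _) (step b _) ∷ cong₂ _⊔_ (step a _) (still b) ∷ cong₂ _⊔_ (step a _) (step b _) ∷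
  cong₂ _⊔_ (still a) (step b _) ∷ cong₂ _⊔_ (still a) (step b _) ∷
  cong₂ _⊔_ (step a _) (step b _) ∷ cong₂ _⊔_ (step a _) (still b) ∷ cong₂ _⊔_ (step a _) (step b _) ∷ []
  where
  negate : ∀ x i → x ℤ.- (x ℤ.+ i) ≡ ℤ.- i
  negate = ℤSolver.solve-∀
  step : ∀ x i → ∣ x ℤ.- (x ℤ.+ i) ∣ ≡ ∣ i ∣
  step x i = trans (cong ∣_∣ (negate x i)) (ℤₚ.∣-i∣≡∣i∣ i)
  still : ∀ x → ∣ x ℤ.- x ∣ ≡ 0
  still x = cong ∣_∣ (ℤₚ.+-inverseʳ x)

Far : V → V → Set
Far v u = 3 ≤ cheb v u

far-sym : ∀ v u → Far v u → Far u v
far-sym v u = subst (3 ≤_) (cheb-sym v u)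

far-from-neighbour : ∀ v u w → Far v u → cheb v w ≡ 1 → 2 ≤ cheb u w
far-from-neighbour v u w far vw≡1 = subst (2 ≤_) (cheb-sym w u) (ℕₚ.≤-pred (begin
  3                         ≤⟨ far ⟩
  cheb v u                  ≤⟨ cheb-triangle v w u ⟩
  cheb v w ℕ.+ cheb w u     ≡⟨ cong (ℕ._+ cheb w u) vw≡1 ⟩
  suc (cheb w u)            ∎))
  where open ℕₚ.≤-Reasoning

≡ᵇ1-false : ∀ {k} → 2 ≤ k → (k ≡ᵇ 1) ≡ false
≡ᵇ1-false (s≤s (s≤s _)) = refl

≡ᵇ0-false : ∀ {k} → 1 ≤ k → (k ≡ᵇ 0) ≡ false
≡ᵇ0-false (s≤s _) = refl

eqV-false : ∀ w x → 1 ≤ cheb x w → eqV w x ≡ false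
eqV-false w x h = ≡ᵇ0-false (subst (1 ≤_) (cheb-sym x w) h)

offset : Fin 5 → ℤ
offset i = + Fin.toℕ i ℤ.- + 2

offset-surjective : ∀ z → ∣ z ∣ ≤ 2 → ∃[ i ] offset i ≡ z
offset-surjective (+ 0)                 _              = Fin.# 2 , refl
offset-surjective (+ 1)                 _              = Fin.# 3 , refl
offset-surjective (+ 2)                 _              = Fin.# 4 , refl
offset-surjective (+ suc (suc (suc _))) (s≤s (s≤s ()))
offset-surjective -[1+ 0 ]              _              = Fin.# 1 , refl
offset-surjective -[1+ 1 ]              _              = Fin.# 0 , refl
offset-surjective -[1+ suc (suc _) ]    (s≤s (s≤s ()))

near-offset : ∀ v u → ¬ Far v u → ∃[ i ] ∃[ j ] u ≡ v +ᵥ (offset i , offset j)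
near-offset (a , b) (c , d) near
  with offset-surjective (c ℤ.- a) (coordinate a c (ℕₚ.m⊔n≤o⇒m≤o _ _ close))
     | offset-surjective (d ℤ.- b) (coordinate b d (ℕₚ.m⊔n≤o⇒n≤o _ _ close))
  where
  close : cheb (a , b) (c , d) ≤ 2
  close = ℕₚ.≮⇒≥ near
  coordinate : ∀ x y → ∣ x ℤ.- y ∣ ≤ 2 → ∣ y ℤ.- x ∣ ≤ 2
  coordinate x y = subst (_≤ 2) (ℤₚ.∣i-j∣≡∣j-i∣ x y)
... | i , offset-i | j , offset-j = i , j , cong₂ _,_
  (trans (restore a c) (cong (λ z → a ℤ.+ z) (sym offset-i)))
  (trans (restore b d) (cong (λ z → b ℤ.+ z) (sym offset-j)))
  where
  restore : ∀ x y → y ≡ x ℤ.+ (y ℤ.- x)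
  restore = ℤSolver.solve-∀

-- Pair profiles

data Excluded : Set where
  none first second both : Excluded

excluded : Excluded → V → V → List V
excluded none   v u = []
excluded first  v u = v ∷ []
excluded second v u = u ∷ []
excluded both   v u = v ∷ u ∷ []

inList-excluded : ∀ e w v u → eqV w v ≡ false → eqV w u ≡ false →
                  inList w (excluded e v u) ≡ false
inList-excluded none   w v u _   _   = refl
inList-excluded first  w v u w≢v _   rewrite w≢v = refl
inList-excluded second w v u _   w≢u rewrite w≢u = refl
inList-excluded both   w v u w≢v w≢u rewrite w≢v | w≢u = refl

Profile : Set
Profile = Bool × Bool × ℕ × ℕ

pairProfile : Subset → Excluded → V → V → Profile
pairProfile S e v u = S v , S u , diffEx S v u (excluded e v u) , diffEx S u v (excluded e v u)

farProfile : Subset → V → V → Profile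
farProfile S v u = S v , S u , count S (N v) , count S (N u)

pairProfile-+ᵥ : ∀ {S} t → Invariant S t → ∀ e v u →
                 pairProfile S e (v +ᵥ t) (u +ᵥ t) ≡ pairProfile S e v u
pairProfile-+ᵥ {S} t inv e v u =
  cong₂ _,_ (inv v) (cong₂ _,_ (inv u) (cong₂ _,_ (translate e v u) (translate e u v)))
  where
  translate : ∀ e x y →
              diffEx S (x +ᵥ t) (y +ᵥ t) (excluded e (v +ᵥ t) (u +ᵥ t)) ≡ diffEx S x y (excluded e v u)
  translate none   x y = diffEx-+ᵥ inv x y []
  translate first  x y = diffEx-+ᵥ inv x y (v ∷ [])
  translate second x y = diffEx-+ᵥ inv x y (u ∷ [])
  translate both   x y = diffEx-+ᵥ inv x y (v ∷ u ∷ [])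

diffEx-far : ∀ S v u X → Far v u → (∀ w → cheb v w ≡ 1 → inList w X ≡ false) →
             diffEx S v u X ≡ count S (N v)
diffEx-far S v u X far notExcluded =
  count-congᴬ (All.map (λ {w} vw≡1 → onlyMembership w vw≡1) (N-adjacent v))
  where
  onlyMembership : ∀ w → cheb v w ≡ 1 → (S w ∧ not (adj u w) ∧ not (inList w X)) ≡ S w
  onlyMembership w vw≡1 = trans
    (cong₂ (λ adjacent excluded → S w ∧ not adjacent ∧ not excluded)
      (≡ᵇ1-false (far-from-neighbour v u w far vw≡1)) (notExcluded w vw≡1))
    (Boolₚ.∧-identityʳ (S w))

pairProfile-far : ∀ S e v u → Far v u → pairProfile S e v u ≡ farProfile S v u
pairProfile-far S e v u far = cong₂ _,_ refl (cong₂ _,_ refl (cong₂ _,_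
  (diffEx-far S v u (excluded e v u) far (λ w vw≡1 → inList-excluded e w v u
    (eqV-false w v (ℕₚ.≤-reflexive (sym vw≡1)))
    (eqV-false w u (ℕₚ.<⇒≤ (far-from-neighbour v u w far vw≡1)))))
  (diffEx-far S u v (excluded e v u) (far-sym v u far) (λ w uw≡1 → inList-excluded e w v u
    (eqV-false w v (ℕₚ.<⇒≤ (far-from-neighbour u v w (far-sym v u far) uw≡1)))
    (eqV-false w u (ℕₚ.≤-reflexive (sym uw≡1)))))))

-- Each condition on pairs in RedLD, DetLD and ErrLD is Condition b₁ b₂ R (pairProfile S e v u).
Condition : Bool → Bool → (ℕ → ℕ → Set) → Profile → Set
Condition b₁ b₂ R (s₁ , s₂ , d₁ , d₂) = s₁ ≡ b₁ → s₂ ≡ b₂ → R d₁ d₂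

condition? : ∀ b₁ b₂ {R : ℕ → ℕ → Set} → (∀ m n → Dec (R m n)) → Decidable (Condition b₁ b₂ R)
condition? b₁ b₂ R? (s₁ , s₂ , d₁ , d₂) = (s₁ Boolₚ.≟ b₁) →-dec (s₂ Boolₚ.≟ b₂) →-dec R? d₁ d₂

different-membership⇒≢ : ∀ (S : Subset) {v u b} → S v ≡ b → S u ≡ not b → u ≢ v
different-membership⇒≢ S {b = b} Sv≡b Su≡¬b refl = Boolₚ.not-¬ refl (trans (sym Sv≡b) Su≡¬b)

-- Counting in boxes and densities

Within : ℕ → ℕ → ℕ → Set
Within e x y = x ≤ y ℕ.+ e × y ≤ x ℕ.+ e

within-small : ∀ {e x y} → x ≤ e → y ≤ e → Within e x y
within-small {e} {x} {y} x≤e y≤e = ℕₚ.≤-trans x≤e (ℕₚ.m≤n+m e y) , ℕₚ.≤-trans y≤e (ℕₚ.m≤n+m e x)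

within-+ˡ : ∀ a {e x y} → Within e x y → Within e (a ℕ.+ x) (a ℕ.+ y)
within-+ˡ a {e} {x} {y} (x≤ , y≤) =
  ℕₚ.≤-trans (ℕₚ.+-monoʳ-≤ a x≤) (ℕₚ.≤-reflexive (sym (ℕₚ.+-assoc a y e))) ,
  ℕₚ.≤-trans (ℕₚ.+-monoʳ-≤ a y≤) (ℕₚ.≤-reflexive (sym (ℕₚ.+-assoc a x e)))

within-*ˡ : ∀ c {e x y} → Within e x y → Within (c ℕ.* e) (c ℕ.* x) (c ℕ.* y)
within-*ˡ c {e} {x} {y} (x≤ , y≤) =
  ℕₚ.≤-trans (ℕₚ.*-monoʳ-≤ c x≤) (ℕₚ.≤-reflexive (ℕₚ.*-distribˡ-+ c y e)) ,
  ℕₚ.≤-trans (ℕₚ.*-monoʳ-≤ c y≤) (ℕₚ.≤-reflexive (ℕₚ.*-distribˡ-+ c x e))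

within-*ʳ : ∀ c {e x y} → Within e x y → Within (e ℕ.* c) (x ℕ.* c) (y ℕ.* c)
within-*ʳ c {e} {x} {y} (x≤ , y≤) =
  ℕₚ.≤-trans (ℕₚ.*-monoˡ-≤ c x≤) (ℕₚ.≤-reflexive (ℕₚ.*-distribʳ-+ c y e)) ,
  ℕₚ.≤-trans (ℕₚ.*-monoˡ-≤ c y≤) (ℕₚ.≤-reflexive (ℕₚ.*-distribʳ-+ c x e))

within-trans : ∀ {e e′ x y z} → Within e x y → Within e′ y z → Within (e ℕ.+ e′) x z
within-trans {e} {e′} {x} {y} {z} (x≤ , y≤) (y≤′ , z≤) =
  ℕₚ.≤-trans x≤ (ℕₚ.≤-trans (ℕₚ.+-monoˡ-≤ e y≤′) (ℕₚ.≤-reflexive (rearrange z e′ e))) ,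
  ℕₚ.≤-trans z≤ (ℕₚ.≤-trans (ℕₚ.+-monoˡ-≤ e′ y≤) (ℕₚ.≤-reflexive (ℕₚ.+-assoc x e e′)))
  where
  rearrange : ∀ a b c → a ℕ.+ b ℕ.+ c ≡ a ℕ.+ (c ℕ.+ b)
  rearrange = ℕSolver.solve-∀

within-cong : ∀ {e e′ x x′ y y′} → e ≡ e′ → x ≡ x′ → y ≡ y′ → Within e x y → Within e′ x′ y′
within-cong refl refl refl w = w

window : (ℤ₄ → ℕ) → ℤ₄ → ℕ → ℕ
window f r zero    = 0
window f r (suc L) = f r ℕ.+ window f (suc₄ r) L

total : (ℤ₄ → ℕ) → ℕ
total f = f 0₄ ℕ.+ (f 1₄ ℕ.+ (f 2₄ ℕ.+ f 3₄))

window-4+ : ∀ f r L → window f r (4 ℕ.+ L) ≡ total f ℕ.+ window f r L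
window-4+ f r L rewrite suc₄⁴ r = trans
  (regroup (f r) (f (suc₄ r)) (f (suc₄ (suc₄ r))) (f (pred₄ r)) (window f r L))
  (cong (ℕ._+ window f r L) (rotation r))
  where
  regroup : ∀ a b c d w → a ℕ.+ (b ℕ.+ (c ℕ.+ (d ℕ.+ w))) ≡ a ℕ.+ (b ℕ.+ (c ℕ.+ d)) ℕ.+ w
  regroup = ℕSolver.solve-∀
  rotate : ∀ a b c d → a ℕ.+ (b ℕ.+ (c ℕ.+ d)) ≡ d ℕ.+ (a ℕ.+ (b ℕ.+ c))
  rotate = ℕSolver.solve-∀
  rotation : ∀ r → f r ℕ.+ (f (suc₄ r) ℕ.+ (f (suc₄ (suc₄ r)) ℕ.+ f (suc₄ (suc₄ (suc₄ r))))) ≡ total f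
  rotation 0₄ = refl
  rotation 1₄ = rotate (f 1₄) (f 2₄) (f 3₄) (f 0₄)
  rotation 2₄ = trans (rotate (f 2₄) (f 3₄) (f 0₄) (f 1₄)) (rotation 1₄)
  rotation 3₄ = trans (rotate (f 3₄) (f 0₄) (f 1₄) (f 2₄))
                      (trans (rotate (f 2₄) (f 3₄) (f 0₄) (f 1₄)) (rotation 1₄))

window-+ : ∀ f g r L → window (λ z → f z ℕ.+ g z) r L ≡ window f r L ℕ.+ window g r L
window-+ f g r zero    = refl
window-+ f g r (suc L) = trans (cong (f r ℕ.+ g r ℕ.+_) (window-+ f g (suc₄ r) L))
                               (interchange (f r) (g r) (window f (suc₄ r) L) (window g (suc₄ r) L))
  where
  interchange : ∀ a b c d → a ℕ.+ b ℕ.+ (c ℕ.+ d) ≡ a ℕ.+ c ℕ.+ (b ℕ.+ d)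
  interchange = ℕSolver.solve-∀

total-window : ∀ (f : ℤ₄ → ℤ₄ → ℕ) r L →
               total (λ z → window (f z) r L) ≡ window (λ z′ → total λ z → f z z′) r L
total-window f r L = sym (begin
  window (λ z′ → total λ z → f z z′) r L                                  ≡⟨ window-+ (f 0₄) _ r L ⟩
  window (f 0₄) r L ℕ.+ window (λ z′ → f 1₄ z′ ℕ.+ (f 2₄ z′ ℕ.+ f 3₄ z′)) r L
    ≡⟨ cong (window (f 0₄) r L ℕ.+_) (window-+ (f 1₄) _ r L) ⟩
  window (f 0₄) r L ℕ.+ (window (f 1₄) r L ℕ.+ window (λ z′ → f 2₄ z′ ℕ.+ f 3₄ z′) r L)
    ≡⟨ cong (λ w → window (f 0₄) r L ℕ.+ (window (f 1₄) r L ℕ.+ w)) (window-+ (f 2₄) (f 3₄) r L) ⟩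
  total (λ z → window (f z) r L)                                          ∎)
  where open ≡-Reasoning

Bounded : (ℤ₄ → ℕ) → ℕ → Set
Bounded f B = ∀ z → f z ≤ B

window-≤ : ∀ {f B} → Bounded f B → ∀ r L → window f r L ≤ L ℕ.* B
window-≤ bounded r zero    = z≤n
window-≤ bounded r (suc L) = ℕₚ.+-mono-≤ (bounded r) (window-≤ bounded (suc₄ r) L)

total-≤ : ∀ {f B} → Bounded f B → total f ≤ 4 ℕ.* B
total-≤ {f} {B} bounded = ℕₚ.≤-trans
  (ℕₚ.+-mono-≤ (bounded 0₄) (ℕₚ.+-mono-≤ (bounded 1₄) (ℕₚ.+-mono-≤ (bounded 2₄) (bounded 3₄))))
  (ℕₚ.≤-reflexive (four B))
  where
  four : ∀ B → B ℕ.+ (B ℕ.+ (B ℕ.+ B)) ≡ 4 ℕ.* B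
  four = ℕSolver.solve-∀

short-window : ∀ {f B} → Bounded f B → ∀ r L → L ≤ 3 →
               Within (12 ℕ.* B) (4 ℕ.* window f r L) (total f ℕ.* L)
short-window {f} {B} bounded r L L≤3 = within-small
  (begin
    4 ℕ.* window f r L    ≤⟨ ℕₚ.*-monoʳ-≤ 4 (window-≤ bounded r L) ⟩
    4 ℕ.* (L ℕ.* B)       ≤⟨ ℕₚ.*-monoʳ-≤ 4 (ℕₚ.*-monoˡ-≤ B L≤3) ⟩
    4 ℕ.* (3 ℕ.* B)       ≡⟨ ℕₚ.*-assoc 4 3 B ⟨
    12 ℕ.* B              ∎)
  (begin
    total f ℕ.* L         ≤⟨ ℕₚ.*-mono-≤ (total-≤ bounded) L≤3 ⟩
    4 ℕ.* B ℕ.* 3         ≡⟨ ℕₚ.*-comm (4 ℕ.* B) 3 ⟩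
    3 ℕ.* (4 ℕ.* B)       ≡⟨ ℕₚ.*-assoc 3 4 B ⟨
    12 ℕ.* B              ∎)
  where open ℕₚ.≤-Reasoning

window-estimate : ∀ {f B} → Bounded f B → ∀ r L →
                  Within (12 ℕ.* B) (4 ℕ.* window f r L) (total f ℕ.* L)
window-estimate bounded r 0 = short-window bounded r 0 z≤n
window-estimate bounded r 1 = short-window bounded r 1 (s≤s z≤n)
window-estimate bounded r 2 = short-window bounded r 2 (s≤s (s≤s z≤n))
window-estimate bounded r 3 = short-window bounded r 3 (s≤s (s≤s (s≤s z≤n)))
window-estimate {f} bounded r (suc (suc (suc (suc L)))) =
  subst₂ (Within _) (sym longer) (distribute (total f) L)
    (within-+ˡ (4 ℕ.* total f) (window-estimate bounded r L))
  where
  distribute : ∀ T L → 4 ℕ.* T ℕ.+ T ℕ.* L ≡ T ℕ.* (4 ℕ.+ L)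
  distribute = ℕSolver.solve-∀
  longer : 4 ℕ.* window f r (4 ℕ.+ L) ≡ 4 ℕ.* total f ℕ.+ 4 ℕ.* window f r L
  longer = trans (cong (4 ℕ.*_) (window-4+ f r L)) (ℕₚ.*-distribˡ-+ 4 (total f) (window f r L))

sum-applyUpTo : ∀ f (g : ℕ → ℤ) → (∀ k → g (suc k) ≡ g k ℤ.+ 1ℤ) →
                ∀ L → sum (map (f ∘ [_]₄) (applyUpTo g L)) ≡ window f [ g 0 ]₄ L
sum-applyUpTo f g step zero    = refl
sum-applyUpTo f g step (suc L) = cong (f [ g 0 ]₄ ℕ.+_) (trans
  (sum-applyUpTo f (g ∘ suc) (step ∘ suc) L)
  (cong (λ r → window f r L) (trans (cong [_]₄ (step 0)) ([x+1]₄ (g 0)))))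

side : ℕ → ℕ
side n = suc (n ℕ.+ n)

corner : ℕ → ℤ₄
corner n = [ + 0 ℤ.- + n ]₄

sum-range : ∀ f n → sum (map (f ∘ [_]₄) (range n)) ≡ window f (corner n) (side n)
sum-range f n = trans (cong (sum ∘ map (f ∘ [_]₄)) (Listₚ.map-applyUpTo (λ k → k) coordinate (side n)))
                      (sum-applyUpTo f coordinate step (side n))
  where
  coordinate : ℕ → ℤ
  coordinate k = + k ℤ.- + n
  shift : ∀ a b → (1ℤ ℤ.+ a) ℤ.- b ≡ (a ℤ.- b) ℤ.+ 1ℤ
  shift = ℤSolver.solve-∀
  step : ∀ k → coordinate (suc k) ≡ coordinate k ℤ.+ 1ℤ
  step k = shift (+ k) (+ n)

positive-as-fraction : ∀ ε → 0ℚ ℚ.< ε → ∃[ e ] ∃[ D ] ε ≡ + suc e / suc D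
positive-as-fraction ε@(mkℚ (+ suc e) D _) _ = e , D , sym (ℚₚ.fromℚᵘ-toℚᵘ ε)
positive-as-fraction (mkℚ (+ zero) _ _)   (ℚ.*<* (ℤ.+<+ ()))
positive-as-fraction (mkℚ -[1+ _ ] _ _)   (ℚ.*<* ())

fraction-≤-sum : ∀ a x b y c z → a ℕ.* (suc y ℕ.* suc z) ≤ (b ℕ.* suc z ℕ.+ c ℕ.* suc y) ℕ.* suc x →
                 + a / suc x ≤ᵠ + b / suc y ℚ.+ + c / suc z
fraction-≤-sum a x b y c z h = ℚₚ.toℚᵘ-cancel-≤ (begin
  toℚᵘ (+ a / suc x)                            ≃⟨ ℚₚ.toℚᵘ-fromℚᵘ (mkℚᵘ (+ a) x) ⟩
  mkℚᵘ (+ a) x                                  ≤⟨ *≤* (subst₂ ℤ._≤_ (ℤₚ.pos-* a _) numerator (+≤+ h)) ⟩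
  mkℚᵘ (+ b) y ℚᵘ.+ mkℚᵘ (+ c) z                ≃⟨ ℚᵘₚ.+-cong (ℚₚ.toℚᵘ-fromℚᵘ (mkℚᵘ (+ b) y))
                                                               (ℚₚ.toℚᵘ-fromℚᵘ (mkℚᵘ (+ c) z)) ⟨
  toℚᵘ (+ b / suc y) ℚᵘ.+ toℚᵘ (+ c / suc z)    ≃⟨ ℚₚ.toℚᵘ-homo-+ (+ b / suc y) (+ c / suc z) ⟨
  toℚᵘ (+ b / suc y ℚ.+ + c / suc z)            ∎)
  where
  open ℚᵘₚ.≤-Reasoning
  numerator : + ((b ℕ.* suc z ℕ.+ c ℕ.* suc y) ℕ.* suc x) ≡
              (+ b ℤ.* + suc z ℤ.+ + c ℤ.* + suc y) ℤ.* + suc x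
  numerator = trans (ℤₚ.pos-* (b ℕ.* suc z ℕ.+ c ℕ.* suc y) (suc x)) (cong (ℤ._* + suc x)
    (trans (ℤₚ.pos-+ (b ℕ.* suc z) _) (cong₂ ℤ._+_ (ℤₚ.pos-* b _) (ℤₚ.pos-* c _))))

≤-+⇒-≤ : ∀ p q r → p ≤ᵠ q ℚ.+ r → p ℚ.- r ≤ᵠ q
≤-+⇒-≤ p q r h = subst (p ℚ.- r ≤ᵠ_) cancel (ℚₚ.+-monoˡ-≤ (ℚ.- r) h)
  where
  cancel : q ℚ.+ r ℚ.- r ≡ q
  cancel = trans (ℚₚ.+-assoc q r (ℚ.- r)) (trans (cong (q ℚ.+_) (ℚₚ.+-inverseʳ r)) (ℚₚ.+-identityʳ q))

density-from-estimate : ∀ S C d K .{{_ : NonZero d}} →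
  (∀ n → Within (K ℕ.* side n) (d ℕ.* countQ S n) (C ℕ.* (side n ℕ.* side n))) → HasDensity S (+ C / d)
density-from-estimate S C d@(suc _) K estimate = upper , lower
  where
  n≤side : ∀ n → n ≤ side n
  n≤side n = ℕₚ.≤-trans (ℕₚ.m≤m+n n n) (ℕₚ.n≤1+n (n ℕ.+ n))

  -- With ε = e/D, the estimate gives |ratio S n - C/d| ≤ K/(d · side n) ≤ ε once K · D ≤ side n.
  fractions : ∀ e D n → K ℕ.* suc D ≤ side n →
              ratio S n ≤ᵠ + C / d ℚ.+ + suc e / suc D × + C / d ≤ᵠ ratio S n ℚ.+ + suc e / suc D
  fractions e D-1 n KD≤L =
    fraction-≤-sum c _ C _ (suc e) D-1 above , fraction-≤-sum C _ c _ (suc e) D-1 below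
    where
    open ℕₚ.≤-Reasoning
    D = suc D-1
    L = side n
    Q = L ℕ.* L
    c = countQ S n
    reorder : ∀ c d D → c ℕ.* (d ℕ.* D) ≡ d ℕ.* c ℕ.* D
    reorder = ℕSolver.solve-∀
    distribute : ∀ a b K L D → (a ℕ.* b ℕ.+ K ℕ.* L) ℕ.* D ≡ a ℕ.* b ℕ.* D ℕ.+ K ℕ.* D ℕ.* L
    distribute = ℕSolver.solve-∀
    collectAbove : ∀ C Q D e d → C ℕ.* Q ℕ.* D ℕ.+ e ℕ.* d ℕ.* Q ≡ (C ℕ.* D ℕ.+ e ℕ.* d) ℕ.* Q
    collectAbove = ℕSolver.solve-∀
    collectBelow : ∀ d c D e Q → d ℕ.* c ℕ.* D ℕ.+ e ℕ.* d ℕ.* Q ≡ (c ℕ.* D ℕ.+ e ℕ.* Q) ℕ.* d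
    collectBelow = ℕSolver.solve-∀
    error≤ : K ℕ.* D ℕ.* L ≤ suc e ℕ.* d ℕ.* Q
    error≤ = ℕₚ.≤-trans (ℕₚ.*-monoˡ-≤ L KD≤L) (ℕₚ.m≤n*m Q (suc e ℕ.* d))
    above : c ℕ.* (d ℕ.* D) ≤ (C ℕ.* D ℕ.+ suc e ℕ.* d) ℕ.* Q
    above = begin
      c ℕ.* (d ℕ.* D)                      ≡⟨ reorder c d D ⟩
      d ℕ.* c ℕ.* D                        ≤⟨ ℕₚ.*-monoˡ-≤ D (proj₁ (estimate n)) ⟩
      (C ℕ.* Q ℕ.+ K ℕ.* L) ℕ.* D          ≡⟨ distribute C Q K L D ⟩
      C ℕ.* Q ℕ.* D ℕ.+ K ℕ.* D ℕ.* L      ≤⟨ ℕₚ.+-monoʳ-≤ (C ℕ.* Q ℕ.* D) error≤ ⟩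
      C ℕ.* Q ℕ.* D ℕ.+ suc e ℕ.* d ℕ.* Q  ≡⟨ collectAbove C Q D (suc e) d ⟩
      (C ℕ.* D ℕ.+ suc e ℕ.* d) ℕ.* Q      ∎
    below : C ℕ.* (Q ℕ.* D) ≤ (c ℕ.* D ℕ.+ suc e ℕ.* Q) ℕ.* d
    below = begin
      C ℕ.* (Q ℕ.* D)                      ≡⟨ ℕₚ.*-assoc C Q D ⟨
      C ℕ.* Q ℕ.* D                        ≤⟨ ℕₚ.*-monoˡ-≤ D (proj₂ (estimate n)) ⟩
      (d ℕ.* c ℕ.+ K ℕ.* L) ℕ.* D          ≡⟨ distribute d c K L D ⟩
      d ℕ.* c ℕ.* D ℕ.+ K ℕ.* D ℕ.* L      ≤⟨ ℕₚ.+-monoʳ-≤ (d ℕ.* c ℕ.* D) error≤ ⟩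
      d ℕ.* c ℕ.* D ℕ.+ suc e ℕ.* d ℕ.* Q  ≡⟨ collectBelow d c D (suc e) Q ⟩
      (c ℕ.* D ℕ.+ suc e ℕ.* Q) ℕ.* d      ∎

  Close : ℚ → ℕ → Set
  Close ε n = ratio S n ≤ᵠ + C / d ℚ.+ ε × + C / d ≤ᵠ ratio S n ℚ.+ ε

  close : ∀ ε → 0ℚ ℚ.< ε → ∃[ M ] ∀ n → M ≤ n → Close ε n
  close ε ε>0 = from (positive-as-fraction ε ε>0)
    where
    from : ∃[ e ] ∃[ D ] ε ≡ + suc e / suc D → ∃[ M ] ∀ n → M ≤ n → Close ε n
    from (e , D-1 , ε≡) = K ℕ.* suc D-1 , λ n M≤n →
      subst (λ ε → Close ε n) (sym ε≡) (fractions e D-1 n (ℕₚ.≤-trans M≤n (n≤side n)))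

  upper : ∀ ε → 0ℚ ℚ.< ε → ∃[ M ] ∀ n → M ≤ n → ratio S n ≤ᵠ + C / d ℚ.+ ε
  upper ε ε>0 = map₂ (λ closeFrom n M≤n → proj₁ (closeFrom n M≤n)) (close ε ε>0)

  lower : ∀ ε → 0ℚ ℚ.< ε → ∀ M → ∃[ n ] (M ≤ n × + C / d ℚ.- ε ≤ᵠ ratio S n)
  lower ε ε>0 M = M ℕ.+ M′ , ℕₚ.m≤m+n M M′ ,
    ≤-+⇒-≤ (+ C / d) (ratio S (M ℕ.+ M′)) ε (proj₂ (proj₂ (close ε ε>0) (M ℕ.+ M′) (ℕₚ.m≤n+m M′ M)))
    where M′ = proj₁ (close ε ε>0)

-- Sets of period 4

IsPeriod : V → Set
IsPeriod (t₁ , t₂) = [ t₁ ]₄ ≡ 0₄ × [ t₂ ]₄ ≡ 0₄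

base : ℤ₄ → ℤ₄ → V
base r s = toℤ r , toℤ s

representative : V → V
representative (a , b) = base [ a ]₄ [ b ]₄

representative-+ᵥ : ∀ v → ∃[ t ] IsPeriod t × v ≡ representative v +ᵥ t
representative-+ᵥ (a , b) =
  (a ℤ.- toℤ [ a ]₄ , b ℤ.- toℤ [ b ]₄) , ([x-toℤ[x]]₄ a , [x-toℤ[x]]₄ b) ,
  cong₂ _,_ (restore a (toℤ [ a ]₄)) (restore b (toℤ [ b ]₄))
  where
  restore : ∀ x y → x ≡ y ℤ.+ (x ℤ.- y)
  restore = ℤSolver.solve-∀

+ᵥ-swap : ∀ v t δ → (v +ᵥ t) +ᵥ δ ≡ (v +ᵥ δ) +ᵥ t
+ᵥ-swap (a , b) (t₁ , t₂) (δ₁ , δ₂) = cong₂ _,_ (swap a t₁ δ₁) (swap b t₂ δ₂)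
  where
  swap : ∀ x t δ → (x ℤ.+ t) ℤ.+ δ ≡ (x ℤ.+ δ) ℤ.+ t
  swap = ℤSolver.solve-∀

all₄? : {P : ℤ₄ → Set} → Decidable P → Dec (∀ r → P r)
all₄? P? = map′ (λ { (p₀ , p₁ , p₂ , p₃) → λ { 0₄ → p₀ ; 1₄ → p₁ ; 2₄ → p₂ ; 3₄ → p₃ } })
                (λ p → p 0₄ , p 1₄ , p 2₄ , p 3₄)
                (P? 0₄ ×-dec P? 1₄ ×-dec P? 2₄ ×-dec P? 3₄)

_≟ᵥ_ : (v w : V) → Dec (v ≡ w)
_≟ᵥ_ = Productₚ.≡-dec ℤ._≟_ ℤ._≟_

module Periodic (tile : ℤ₄ → ℤ₄ → Bool) where

  S : Subset
  S (a , b) = tile [ a ]₄ [ b ]₄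

  S-+ᵥ : ∀ t → IsPeriod t → Invariant S t
  S-+ᵥ (t₁ , t₂) (p₁ , p₂) (a , b) = cong₂ tile (shift a t₁ p₁) (shift b t₂ p₂)
    where
    shift : ∀ x t → [ t ]₄ ≡ 0₄ → [ x ℤ.+ t ]₄ ≡ [ x ]₄
    shift x t p = trans ([+]₄ x t) (cong ([ x ]₄ +₄_) p)

  at-representative : ∀ {A : Set} (f : V → A) → (∀ t → IsPeriod t → ∀ v → f (v +ᵥ t) ≡ f v) →
                      ∀ v → f v ≡ f (representative v)
  at-representative f invariant v with representative-+ᵥ v
  ... | t , period , v≡ = trans (cong f v≡) (invariant t period (representative v))

  dominating : ∀ k → {_ : True (all₄? λ r → all₄? λ s → k ≤? closedCount S (base r s))} →
               ∀ v → k ≤ closedCount S v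
  dominating k {check} v = subst (k ≤_)
    (sym (at-representative (closedCount S) (λ t p → closedCount-+ᵥ (S-+ᵥ t p)) v))
    (toWitness check [ proj₁ v ]₄ [ proj₂ v ]₄)

  NearCheck : Excluded → (Profile → Set) → Set
  NearCheck e P = ∀ r s i j → let b = base r s ; u = b +ᵥ (offset i , offset j) in
                  u ≢ b → P (pairProfile S e b u)

  near? : ∀ e {P} → Decidable P → Dec (NearCheck e P)
  near? e P? = all₄? λ r → all₄? λ s → Finₚ.all? λ i → Finₚ.all? λ j →
    let b = base r s ; u = b +ᵥ (offset i , offset j) in ¬? (u ≟ᵥ b) →-dec P? (pairProfile S e b u)

  FarCheck : (Profile → Set) → Set
  FarCheck P = ∀ r s r′ s′ → P (farProfile S (base r s) (base r′ s′))

  far? : ∀ {P} → Decidable P → Dec (FarCheck P)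
  far? P? = all₄? λ r → all₄? λ s → all₄? λ r′ → all₄? λ s′ →
    P? (farProfile S (base r s) (base r′ s′))

  near-pairs : ∀ e {P} → NearCheck e P → ∀ v u → ¬ Far v u → u ≢ v → P (pairProfile S e v u)
  near-pairs e {P} check v u near u≢v with near-offset v u near | representative-+ᵥ v
  ... | i , j , refl | t , period , v≡ =
    subst P (sym translated) (check [ proj₁ v ]₄ [ proj₂ v ]₄ i j distinct)
    where
    b = representative v
    δ = offset i , offset j
    u≡ : v +ᵥ δ ≡ (b +ᵥ δ) +ᵥ t
    u≡ = trans (cong (_+ᵥ δ) v≡) (+ᵥ-swap b t δ)
    translated : pairProfile S e v (v +ᵥ δ) ≡ pairProfile S e b (b +ᵥ δ)
    translated = trans (cong₂ (pairProfile S e) v≡ u≡)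
                       (pairProfile-+ᵥ t (S-+ᵥ t period) e b (b +ᵥ δ))
    distinct : b +ᵥ δ ≢ b
    distinct b+δ≡b = u≢v (trans u≡ (trans (cong (_+ᵥ t) b+δ≡b) (sym v≡)))

  far-pairs : ∀ e {P} → FarCheck P → ∀ v u → Far v u → P (pairProfile S e v u)
  far-pairs e {P} check v u far = subst P (sym (trans (pairProfile-far S e v u far) atRepresentatives))
    (check [ proj₁ v ]₄ [ proj₂ v ]₄ [ proj₁ u ]₄ [ proj₂ u ]₄)
    where
    membership = at-representative S (λ t p → S-+ᵥ t p)
    neighbours = at-representative (count S ∘ N) (λ t p → count-N-+ᵥ {S} {S} t (S-+ᵥ t p))
    atRepresentatives : farProfile S v u ≡ farProfile S (representative v) (representative u)
    atRepresentatives = cong₂ _,_ (membership v) (cong₂ _,_ (membership u)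
                          (cong₂ _,_ (neighbours v) (neighbours u)))

  separating : ∀ e {P} (P? : Decidable P) → {_ : True (near? e P?)} → {_ : True (far? P?)} →
               ∀ v u → u ≢ v → P (pairProfile S e v u)
  separating e {P} P? {near} {far} v u u≢v =
    [ far-pairs e {P} (toWitness far) v u
    , (λ isNear → near-pairs e {P} (toWitness near) v u isNear u≢v)
    ]′ (toSum (3 ≤? cheb v u))

  rowCount : ℕ → ℤ₄ → ℕ
  rowCount n z = window (indicator ∘ tile z) (corner n) (side n)

  columnCount : ℤ₄ → ℕ
  columnCount z′ = total λ z → indicator (tile z z′)

  cells : ℕ
  cells = total columnCount

  countQ-window : ∀ n → countQ S n ≡ window (rowCount n) (corner n) (side n)
  countQ-window n = begin
    countQ S n                                ≡⟨ count-concatMap S row (range n) ⟩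
    sum (map (count S ∘ row) (range n))       ≡⟨ cong sum (Listₚ.map-cong perRow (range n)) ⟩
    sum (map (rowCount n ∘ [_]₄) (range n))   ≡⟨ sum-range (rowCount n) n ⟩
    window (rowCount n) (corner n) (side n)   ∎
    where
    open ≡-Reasoning
    row : ℤ → List V
    row i = map (i ,_) (range n)
    perRow : ∀ i → count S (row i) ≡ rowCount n [ i ]₄
    perRow i = trans (count-map S (i ,_) (range n)) (trans (count≡sum (tile [ i ]₄ ∘ [_]₄) (range n))
                                                           (sum-range (indicator ∘ tile [ i ]₄) n))

  rowCount-bounded : ∀ n → Bounded (rowCount n) (side n)
  rowCount-bounded n z = subst (rowCount n z ≤_) (ℕₚ.*-identityʳ (side n))
    (window-≤ (indicator≤1 ∘ tile z) (corner n) (side n))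

  columnCount-bounded : Bounded columnCount 4
  columnCount-bounded z′ = total-≤ (λ z → indicator≤1 (tile z z′))

  countQ-estimate : ∀ n → Within (96 ℕ.* side n) (16 ℕ.* countQ S n) (cells ℕ.* (side n ℕ.* side n))
  countQ-estimate n = within-cong (regroup L) sixteen (ℕₚ.*-assoc cells L L)
    (within-trans {4 ℕ.* (12 ℕ.* L)} {12 ℕ.* 4 ℕ.* L}
      (within-cong refl refl (sym (ℕₚ.*-assoc 4 T L)) (within-*ˡ 4 rows)) (within-*ʳ L columns))
    where
    L = side n
    w = window (rowCount n) (corner n) L
    T = total (rowCount n)
    rows : Within (12 ℕ.* L) (4 ℕ.* w) (T ℕ.* L)
    rows = window-estimate (rowCount-bounded n) (corner n) L
    columns : Within (12 ℕ.* 4) (4 ℕ.* T) (cells ℕ.* L)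
    columns = subst (λ T → Within (12 ℕ.* 4) (4 ℕ.* T) (cells ℕ.* L))
      (sym (total-window (λ z z′ → indicator (tile z z′)) (corner n) L))
      (window-estimate columnCount-bounded (corner n) L)
    sixteen : 4 ℕ.* (4 ℕ.* w) ≡ 16 ℕ.* countQ S n
    sixteen = trans (sym (ℕₚ.*-assoc 4 4 w)) (cong (16 ℕ.*_) (sym (countQ-window n)))
    regroup : ∀ L → 4 ℕ.* (12 ℕ.* L) ℕ.+ 12 ℕ.* 4 ℕ.* L ≡ 96 ℕ.* L
    regroup = ℕSolver.solve-∀

  hasDensity : HasDensity S (+ cells / 16)
  hasDensity = density-from-estimate S cells 16 96 countQ-estimate

redTile : ℤ₄ → ℤ₄ → Bool
redTile 0₄ 0₄ = true
redTile 0₄ 2₄ = true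
redTile 1₄ 1₄ = true
redTile 2₄ 0₄ = true
redTile 2₄ 2₄ = true
redTile _  _  = false

module Red = Periodic redTile

redLD : RedLD Red.S
redLD =
  Red.dominating 2 ,
  (λ v u v∈S u∉S → Red.separating first (condition? true false λ m n → 1 ≤? m ℕ.+ n)
                     v u (different-membership⇒≢ Red.S v∈S u∉S) v∈S u∉S) ,
  (λ u v u≢v u∉S v∉S → Red.separating none (condition? false false λ m n → 2 ≤? m ℕ.+ n)
                         v u u≢v v∉S u∉S)

detTile : ℤ₄ → ℤ₄ → Bool
detTile 0₄ 0₄ = true
detTile 0₄ 1₄ = true
detTile 1₄ 0₄ = true
detTile 2₄ 2₄ = true
detTile 2₄ 3₄ = true
detTile 3₄ 2₄ = true
detTile _  _  = false

module Det = Periodic detTile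

detLD : DetLD Det.S
detLD =
  Det.dominating 2 ,
  (λ u v u≢v u∈S v∈S → Det.separating none (condition? true true λ m n → 1 ≤? m ℕ.+ n)
                         v u u≢v v∈S u∈S) ,
  (λ v u v∉S u∈S → Det.separating none (condition? false true λ m n → 2 ≤? m ⊎-dec 1 ≤? n)
                     v u (different-membership⇒≢ Det.S v∉S u∈S) v∉S u∈S) ,
  (λ u v u≢v u∉S v∉S → Det.separating none (condition? false false λ m n → 2 ≤? m ⊎-dec 2 ≤? n)
                         v u u≢v v∉S u∉S)

errTile : ℤ₄ → ℤ₄ → Bool
errTile 0₄ 0₄ = true
errTile 0₄ 1₄ = true
errTile 0₄ 2₄ = true
errTile 1₄ 1₄ = true
errTile 2₄ 0₄ = true
errTile 2₄ 2₄ = true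
errTile 3₄ 3₄ = true
errTile _  _  = false

module Err = Periodic errTile

errLD : ErrLD Err.S
errLD =
  Err.dominating 3 ,
  (λ u v u≢v u∈S v∈S → Err.separating both (condition? true true λ m n → 1 ≤? m ℕ.+ n)
                         v u u≢v v∈S u∈S) ,
  (λ v u v∉S u∈S → Err.separating second (condition? false true λ m n → 2 ≤? m ℕ.+ n)
                     v u (different-membership⇒≢ Err.S v∉S u∈S) v∉S u∈S) ,
  (λ u v u≢v u∉S v∉S → Err.separating none (condition? false false λ m n → 3 ≤? m ℕ.+ n)
                         v u u≢v v∉S u∉S)

mainTheorem1 : (∃[ S ] (RedLD S × HasDensity S ((+ 5) / 16))) ×
    (∃[ S ] (DetLD S × HasDensity S ((+ 3) / 8))) ×
    (∃[ S ] (ErrLD S × HasDensity S ((+ 7) / 16)))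
-- Det.hasDensity is stated for (+ 6) / 16, which normalises to (+ 3) / 8.
mainTheorem1 =
  (Red.S , redLD , Red.hasDensity) ,
  (Det.S , detLD , Det.hasDensity) ,
  (Err.S , errLD , Err.hasDensity)
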